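{- There is no infinite sequence $x_0 \rhd_{rm} x_1 \rhd_{rm} x_2 \rhd_{rm}\cdots$ of well-formed suspension expressions; i.e., every rewriting sequence using only the reading rules (r1)–(r6) and merging rules (m1)–(m6) terminates.
   Context: Suspension calculus with meta variables. Terms $t ::= c \mid v \mid \#i \mid (t\ t)\mid(\lambda\, t)\mid [\![t,n,n,e]\!]$, environments $e::= nil\mid ((t,n)::e)\mid \{\!\{e,n,n,e\}\!\}$, where $c$ ranges over constants, $v$ over meta variables, $n$ over natural numbers, $i$ over positive integers. $m\mathbin{\dot- } n=\max(m-n,0)$. Length: $len(nil)=0$, $len((t,l)::e)=1+len(e)$, $len(\{\!\{e_1,nl_1,ol_2,e_2\}\!\})=len(e_1)+(len(e_2)\mathbin{\dot- } nl_1)$. Level: $lev(nil)=0$, $lev((t,l)::e)=l$, $lev(\{\!\{e_1,nl_1,ol_2,e_2\}\!\})=lev(e_2)+(nl_1\mathbin{\dot- } ol_2)$. Well-formed: every subexpression satisfies: $[\![t,ol,nl,e]\!]$ has $len(e)=ol$, $lev(e)\le nl$; $(t,l)::e$ has $l\ge lev(e)$; $\{\!\{e_1,nl_1,ol_2,e_2\}\!\}$ has $lev(e_1)\le nl_1$, $len(e_2)=ol_2$. Only well-formed expressions are considered. Reading rules: (r1) $[\![c,ol,nl,e]\!]\to c$ ($c$ a constant); (r2) $[\![\#i,0,nl,nil]\!]\to\#(i+nl)$; (r3) $[\![\#1,ol,nl,(t,l)::e]\!]\to[\![t,0,nl-l,nil]\!]$; (r4) $[\![\#i,ol,nl,(t,l)::e]\!]\to[\![\#(i-1),ol-1,nl,e]\!]$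 if $i>1$; (r5) $[\![(t_1\ t_2),ol,nl,e]\!]\to([\![t_1,ol,nl,e]\!]\ [\![t_2,ol,nl,e]\!])$; (r6) $[\![(\lambda t),ol,nl,e]\!]\to(\lambda [\![t,ol+1,nl+1,(\#1,nl+1)::e]\!])$. Merging rules: (m1) $[\![[\![t,ol_1,nl_1,e_1]\!],ol_2,nl_2,e_2]\!]\to[\![t,ol_1+(ol_2\mathbin{\dot- } nl_1),nl_2+(nl_1\mathbin{\dot- } ol_2),\{\!\{e_1,nl_1,ol_2,e_2\}\!\}]\!]$; (m2) $\{\!\{e_1,nl_1,0,nil\}\!\}\to e_1$; (m3) $\{\!\{nil,0,ol_2,e_2\}\!\}\to e_2$; (m4) $\{\!\{nil,nl_1,ol_2,(t,l)::e_2\}\!\}\to\{\!\{nil,nl_1-1,ol_2-1,e_2\}\!\}$ if $nl_1\ge1$; (m5) $\{\!\{(t,n)::e_1,nl_1,ol_2,(s,l)::e_2\}\!\}\to\{\!\{(t,n)::e_1,nl_1-1,ol_2-1,e_2\}\!\}$ if $nl_1>n$; (m6) $\{\!\{(t,n)::e_1,n,ol_2,(s,l)::e_2\}\!\}\to([\![t,ol_2,l,(s,l)::e_2]\!],l+(n\mathbin{\dot- } ol_2))::\{\!\{e_1,n,ol_2,(s,l)::e_2\}\!\}$. There is no rule acting on a meta variable inside a suspension (grafting interpretation). $x\rhd_{rm} y$ means $y$ results from $x$ by applying one of (r1)–(r6),(m1)–(m6) at some subexpression. -}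

module Defs where

open import Data.Nat using (ℕ; zero; suc; _+_; _∸_; _≤_; _<_)
open import Data.Product using (_×_; Σ)
open import Data.Unit using (⊤)
open import Data.Empty using (⊥)
open import Relation.Binary.PropositionalEquality using (_≡_)
open import Relation.Nullary using (¬_)

-- Constants and meta variables are both drawn from ℕ (disjoint constructors).
-- De Bruijn indices #i are naturals; positivity (i ≥ 1) is part of well-formedness.

mutual
  data Term : Set where
    con  : ℕ → Term
    mvar : ℕ → Term
    dB   : ℕ → Term
    app  : Term → Term → Term
    lam  : Term → Term
    susp : Term → ℕ → ℕ → Env → Term

  data Env : Set where
    nil   : Env
    cons  : Term → ℕ → Env → Env
    merge : Env → ℕ → ℕ → Env → Env

len : Env → ℕ
len nil = 0
len (cons t l e) = suc (len e)
len (merge e₁ nl₁ ol₂ e₂) = len e₁ + (len e₂ ∸ nl₁)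

lev : Env → ℕ
lev nil = 0
lev (cons t l e) = l
lev (merge e₁ nl₁ ol₂ e₂) = lev e₂ + (nl₁ ∸ ol₂)

mutual
  WFt : Term → Set
  WFt (con c) = ⊤
  WFt (mvar v) = ⊤
  WFt (dB i) = 1 ≤ i
  WFt (app t₁ t₂) = WFt t₁ × WFt t₂
  WFt (lam t) = WFt t
  WFt (susp t ol nl e) = WFt t × WFe e × len e ≡ ol × lev e ≤ nl

  WFe : Env → Set
  WFe nil = ⊤
  WFe (cons t l e) = WFt t × WFe e × lev e ≤ l
  WFe (merge e₁ nl₁ ol₂ e₂) = WFe e₁ × WFe e₂ × lev e₁ ≤ nl₁ × len e₂ ≡ ol₂

mutual
  data _▷t_ : Term → Term → Set where
    r1 : ∀ {c ol nl e} → susp (con c) ol nl e ▷t con c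
    r2 : ∀ {i nl} → susp (dB i) 0 nl nil ▷t dB (i + nl)
    r3 : ∀ {ol nl t l e} → susp (dB 1) ol nl (cons t l e) ▷t susp t 0 (nl ∸ l) nil
    r4 : ∀ {i ol nl t l e} → 1 < i →
         susp (dB i) ol nl (cons t l e) ▷t susp (dB (i ∸ 1)) (ol ∸ 1) nl e
    r5 : ∀ {t₁ t₂ ol nl e} →
         susp (app t₁ t₂) ol nl e ▷t app (susp t₁ ol nl e) (susp t₂ ol nl e)
    r6 : ∀ {t ol nl e} →
         susp (lam t) ol nl e ▷t lam (susp t (suc ol) (suc nl) (cons (dB 1) (suc nl) e))
    m1 : ∀ {t ol₁ nl₁ e₁ ol₂ nl₂ e₂} →
         susp (susp t ol₁ nl₁ e₁) ol₂ nl₂ e₂ ▷t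
         susp t (ol₁ + (ol₂ ∸ nl₁)) (nl₂ + (nl₁ ∸ ol₂)) (merge e₁ nl₁ ol₂ e₂)
    appˡ  : ∀ {t₁ t₁' t₂} → t₁ ▷t t₁' → app t₁ t₂ ▷t app t₁' t₂
    appʳ  : ∀ {t₁ t₂ t₂'} → t₂ ▷t t₂' → app t₁ t₂ ▷t app t₁ t₂'
    lamᶜ  : ∀ {t t'} → t ▷t t' → lam t ▷t lam t'
    suspᵗ : ∀ {t t' ol nl e} → t ▷t t' → susp t ol nl e ▷t susp t' ol nl e
    suspᵉ : ∀ {t ol nl e e'} → e ▷e e' → susp t ol nl e ▷t susp t ol nl e'

  data _▷e_ : Env → Env → Set where
    m2 : ∀ {e₁ nl₁} → merge e₁ nl₁ 0 nil ▷e e₁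
    m3 : ∀ {ol₂ e₂} → merge nil 0 ol₂ e₂ ▷e e₂
    m4 : ∀ {nl₁ ol₂ t l e₂} → 1 ≤ nl₁ →
         merge nil nl₁ ol₂ (cons t l e₂) ▷e merge nil (nl₁ ∸ 1) (ol₂ ∸ 1) e₂
    m5 : ∀ {t n e₁ nl₁ ol₂ s l e₂} → n < nl₁ →
         merge (cons t n e₁) nl₁ ol₂ (cons s l e₂) ▷e merge (cons t n e₁) (nl₁ ∸ 1) (ol₂ ∸ 1) e₂
    m6 : ∀ {t n e₁ ol₂ s l e₂} →
         merge (cons t n e₁) n ol₂ (cons s l e₂) ▷e
         cons (susp t ol₂ l (cons s l e₂)) (l + (n ∸ ol₂)) (merge e₁ n ol₂ (cons s l e₂))
    consᵗ  : ∀ {t t' l e} → t ▷t t' → cons t l e ▷e cons t' l e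
    consᵉ  : ∀ {t l e e'} → e ▷e e' → cons t l e ▷e cons t l e'
    mergeˡ : ∀ {e₁ e₁' nl₁ ol₂ e₂} → e₁ ▷e e₁' → merge e₁ nl₁ ol₂ e₂ ▷e merge e₁' nl₁ ol₂ e₂
    mergeʳ : ∀ {e₁ nl₁ ol₂ e₂ e₂'} → e₂ ▷e e₂' → merge e₁ nl₁ ol₂ e₂ ▷e merge e₁ nl₁ ol₂ e₂'

InfSeqT : Set
InfSeqT = Σ (ℕ → Term) (λ x → (∀ k → WFt (x k)) × (∀ k → x k ▷t x (suc k)))

InfSeqE : Set
InfSeqE = Σ (ℕ → Env) (λ x → (∀ k → WFe (x k)) × (∀ k → x k ▷e x (suc k)))

-- Every expression is strongly normalising, well-formed or not. Two measures never increase along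
-- a step: the weight, in which λ and application cost one and a suspension adds the weight of its
-- environment, and the closure depth, which counts how deeply terms sit inside environment entries
-- outside λ. Strong normalisation of [[t,ol,nl,e]] from that of t and e then goes by induction on its
-- weight, its closure depth, the weight of t and len e, lexicographically, and on the reductions of
-- t and e: (r5), (r6) and the entry built by (m6) lower the weight, (r3) lowers the closure depth,
-- (m1) replaces t by a strict subterm, and (r4), (m4), (m5) shorten an environment whose length no
-- step changes.
module Submission where

open import Defs
open import Data.Product using (_×_)
open import Relation.Nullary using (¬_)

open import Data.Nat using (ℕ; zero; suc; _+_; _∸_; _≤_; _<_; _⊔_; z≤n; s≤s)
open import Data.Nat.Properties
open import Data.Nat.Induction using (<-wellFounded)
open import Data.Product using (_,_)
open import Function using (_∘_; flip)
open import Induction.WellFounded using (Acc; acc; WfRec; module Subrelation)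
open import Induction.InfiniteDescent using (InfiniteDescendingSequence)
open import Level using (Level)
open import Relation.Binary.Core using (Rel)
import Relation.Binary.Construct.On as On
open import Relation.Binary.PropositionalEquality using (_≡_; refl; sym; trans; cong)

module _ {a b ℓ₁ ℓ₂ : Level} {A : Set a} {B : Set b} {_<₁_ : Rel A ℓ₁} {_<₂_ : Rel B ℓ₂} where

  Acc-reflect : (f : A → B) → (∀ {x y} → x <₁ y → f x <₂ f y) →
                ∀ {x} → Acc _<₂_ (f x) → Acc _<₁_ x
  Acc-reflect f mono = Subrelation.accessible mono ∘ On.accessible f

module _ {a ℓ : Level} {A : Set a} {_<_ : Rel A ℓ} where

  acc⇒¬infiniteDescent : ∀ {f : ℕ → A} → Acc _<_ (f zero) → ¬ InfiniteDescendingSequence _<_ f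
  acc⇒¬infiniteDescent (acc rs) desc = acc⇒¬infiniteDescent (rs (desc zero)) (desc ∘ suc)

SNₜ : Term → Set
SNₜ = Acc (flip _▷t_)

SNₑ : Env → Set
SNₑ = Acc (flip _▷e_)

SNₜ-appˡ : ∀ {t u} → SNₜ (app t u) → SNₜ t
SNₜ-appˡ {u = u} = Acc-reflect (λ t → app t u) appˡ

SNₜ-appʳ : ∀ {t u} → SNₜ (app t u) → SNₜ u
SNₜ-appʳ {t} = Acc-reflect (app t) appʳ

SNₜ-lam : ∀ {t} → SNₜ (lam t) → SNₜ t
SNₜ-lam = Acc-reflect lam lamᶜ

SNₜ-susp-term : ∀ {t ol nl e} → SNₜ (susp t ol nl e) → SNₜ t
SNₜ-susp-term {ol = ol} {nl} {e} = Acc-reflect (λ t → susp t ol nl e) suspᵗ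

SNₜ-susp-env : ∀ {t ol nl e} → SNₜ (susp t ol nl e) → SNₑ e
SNₜ-susp-env {t} {ol} {nl} = Acc-reflect (susp t ol nl) suspᵉ

SNₑ-cons-term : ∀ {t l e} → SNₑ (cons t l e) → SNₜ t
SNₑ-cons-term {l = l} {e} = Acc-reflect (λ t → cons t l e) consᵗ

SNₑ-cons-env : ∀ {t l e} → SNₑ (cons t l e) → SNₑ e
SNₑ-cons-env {t} {l} = Acc-reflect (cons t l) consᵉ

con-SNₜ : ∀ {c} → SNₜ (con c)
con-SNₜ = acc λ ()

mvar-SNₜ : ∀ {v} → SNₜ (mvar v)
mvar-SNₜ = acc λ ()

dB-SNₜ : ∀ {i} → SNₜ (dB i)
dB-SNₜ = acc λ ()

app-SNₜ : ∀ {t u} → SNₜ t → SNₜ u → SNₜ (app t u)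
app-SNₜ sn-t@(acc rec-t) sn-u@(acc rec-u) = acc λ
  { (appˡ step) → app-SNₜ (rec-t step) sn-u
  ; (appʳ step) → app-SNₜ sn-t (rec-u step)
  }

lam-SNₜ : ∀ {t} → SNₜ t → SNₜ (lam t)
lam-SNₜ (acc rec) = acc λ { (lamᶜ step) → lam-SNₜ (rec step) }

nil-SNₑ : SNₑ nil
nil-SNₑ = acc λ ()

cons-SNₑ : ∀ {t l e} → SNₜ t → SNₑ e → SNₑ (cons t l e)
cons-SNₑ sn-t@(acc rec-t) sn-e@(acc rec-e) = acc λ
  { (consᵗ step) → cons-SNₑ (rec-t step) sn-e
  ; (consᵉ step) → cons-SNₑ sn-t (rec-e step)
  }

-- nil weighs 1 so that the body of a suspension is strictly lighter than the suspension (m1),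
-- while the entry (#1, nl+1) pushed by (r6) adds nothing.
mutual
  weight : Term → ℕ
  weight (con _) = 0
  weight (mvar _) = 0
  weight (dB _) = 0
  weight (app t u) = suc (weight t ⊔ weight u)
  weight (lam t) = suc (weight t)
  weight (susp t _ _ e) = weight t + weightₑ e

  weightₑ : Env → ℕ
  weightₑ nil = 1
  weightₑ (cons t _ e) = suc (weight t) ⊔ weightₑ e
  weightₑ (merge e₁ _ _ e₂) = weightₑ e₁ + weightₑ e₂

1≤weightₑ : ∀ e → 1 ≤ weightₑ e
1≤weightₑ nil = ≤-refl
1≤weightₑ (cons t _ e) = ≤-trans (s≤s z≤n) (m≤m⊔n (suc (weight t)) (weightₑ e))
1≤weightₑ (merge e₁ _ _ e₂) = ≤-trans (1≤weightₑ e₁) (m≤m+n (weightₑ e₁) (weightₑ e₂))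

mutual
  ▷t⇒weight≤ : ∀ {t u} → t ▷t u → weight u ≤ weight t
  ▷t⇒weight≤ r1 = z≤n
  ▷t⇒weight≤ r2 = z≤n
  ▷t⇒weight≤ (r3 {t = t} {e = e}) =
    ≤-trans (≤-reflexive (+-comm (weight t) 1)) (m≤m⊔n (suc (weight t)) (weightₑ e))
  ▷t⇒weight≤ (r4 {t = t} {e = e} _) = m≤n⊔m (suc (weight t)) (weightₑ e)
  ▷t⇒weight≤ (r5 {t₁ = t} {t₂ = u} {e = e}) =
    s≤s (≤-reflexive (sym (+-distribʳ-⊔ (weightₑ e) (weight t) (weight u))))
  ▷t⇒weight≤ (r6 {t = t} {e = e}) =
    s≤s (≤-reflexive (cong (weight t +_) (m≤n⇒m⊔n≡n (1≤weightₑ e))))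
  ▷t⇒weight≤ (m1 {t = t} {e₁ = e₁} {e₂ = e₂}) =
    ≤-reflexive (sym (+-assoc (weight t) (weightₑ e₁) (weightₑ e₂)))
  ▷t⇒weight≤ (appˡ {t₂ = u} step) = s≤s (⊔-monoˡ-≤ (weight u) (▷t⇒weight≤ step))
  ▷t⇒weight≤ (appʳ {t₁ = t} step) = s≤s (⊔-monoʳ-≤ (weight t) (▷t⇒weight≤ step))
  ▷t⇒weight≤ (lamᶜ step) = s≤s (▷t⇒weight≤ step)
  ▷t⇒weight≤ (suspᵗ {e = e} step) = +-monoˡ-≤ (weightₑ e) (▷t⇒weight≤ step)
  ▷t⇒weight≤ (suspᵉ {t = t} step) = +-monoʳ-≤ (weight t) (▷e⇒weightₑ≤ step)

  ▷e⇒weightₑ≤ : ∀ {e e′} → e ▷e e′ → weightₑ e′ ≤ weightₑ e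
  ▷e⇒weightₑ≤ (m2 {e₁ = e₁}) = m≤m+n (weightₑ e₁) 1
  ▷e⇒weightₑ≤ (m3 {e₂ = e₂}) = m≤n+m (weightₑ e₂) 1
  ▷e⇒weightₑ≤ (m4 {t = t} {e₂ = e₂} _) = +-monoʳ-≤ 1 (m≤n⊔m (suc (weight t)) (weightₑ e₂))
  ▷e⇒weightₑ≤ (m5 {t = t} {n = n} {e₁ = e₁} {s = s} {e₂ = e₂} _) =
    +-monoʳ-≤ (weightₑ (cons t n e₁)) (m≤n⊔m (suc (weight s)) (weightₑ e₂))
  ▷e⇒weightₑ≤ (m6 {t = t} {e₁ = e₁} {s = s} {l = l} {e₂ = e₂}) =
    ≤-reflexive (sym (+-distribʳ-⊔ (weightₑ (cons s l e₂)) (suc (weight t)) (weightₑ e₁)))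
  ▷e⇒weightₑ≤ (consᵗ {e = e} step) = ⊔-monoˡ-≤ (weightₑ e) (s≤s (▷t⇒weight≤ step))
  ▷e⇒weightₑ≤ (consᵉ {t = t} step) = ⊔-monoʳ-≤ (suc (weight t)) (▷e⇒weightₑ≤ step)
  ▷e⇒weightₑ≤ (mergeˡ {e₂ = e₂} step) = +-monoˡ-≤ (weightₑ e₂) (▷e⇒weightₑ≤ step)
  ▷e⇒weightₑ≤ (mergeʳ {e₁ = e₁} step) = +-monoʳ-≤ (weightₑ e₁) (▷e⇒weightₑ≤ step)

-- λ resets the depth so that the entry pushed by (r6) cannot raise it.
mutual
  depth : Term → ℕ
  depth (con _) = 0
  depth (mvar _) = 0
  depth (dB _) = 0
  depth (app t u) = depth t ⊔ depth u
  depth (lam _) = 0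
  depth (susp t _ _ e) = depth t + depthₑ e

  depthₑ : Env → ℕ
  depthₑ nil = 0
  depthₑ (cons t _ e) = suc (depth t) ⊔ depthₑ e
  depthₑ (merge e₁ _ _ e₂) = depthₑ e₁ + depthₑ e₂

depth-r3< : ∀ {t k ol nl l e} → depth (susp t 0 k nil) < depth (susp (dB 1) ol nl (cons t l e))
depth-r3< {t} {e = e} =
  ≤-trans (s≤s (≤-reflexive (+-identityʳ (depth t)))) (m≤m⊔n (suc (depth t)) (depthₑ e))

mutual
  ▷t⇒depth≤ : ∀ {t u} → t ▷t u → depth u ≤ depth t
  ▷t⇒depth≤ r1 = z≤n
  ▷t⇒depth≤ r2 = z≤n
  ▷t⇒depth≤ (r3 {ol} {nl} {t} {l} {e}) = <⇒≤ (depth-r3< {t} {nl ∸ l} {ol} {nl} {l} {e})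
  ▷t⇒depth≤ (r4 {t = t} {e = e} _) = m≤n⊔m (suc (depth t)) (depthₑ e)
  ▷t⇒depth≤ (r5 {t₁ = t} {t₂ = u} {e = e}) =
    ≤-reflexive (sym (+-distribʳ-⊔ (depthₑ e) (depth t) (depth u)))
  ▷t⇒depth≤ r6 = z≤n
  ▷t⇒depth≤ (m1 {t = t} {e₁ = e₁} {e₂ = e₂}) =
    ≤-reflexive (sym (+-assoc (depth t) (depthₑ e₁) (depthₑ e₂)))
  ▷t⇒depth≤ (appˡ {t₂ = u} step) = ⊔-monoˡ-≤ (depth u) (▷t⇒depth≤ step)
  ▷t⇒depth≤ (appʳ {t₁ = t} step) = ⊔-monoʳ-≤ (depth t) (▷t⇒depth≤ step)
  ▷t⇒depth≤ (lamᶜ _) = z≤n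
  ▷t⇒depth≤ (suspᵗ {e = e} step) = +-monoˡ-≤ (depthₑ e) (▷t⇒depth≤ step)
  ▷t⇒depth≤ (suspᵉ {t = t} step) = +-monoʳ-≤ (depth t) (▷e⇒depthₑ≤ step)

  ▷e⇒depthₑ≤ : ∀ {e e′} → e ▷e e′ → depthₑ e′ ≤ depthₑ e
  ▷e⇒depthₑ≤ (m2 {e₁ = e₁}) = m≤m+n (depthₑ e₁) 0
  ▷e⇒depthₑ≤ m3 = ≤-refl
  ▷e⇒depthₑ≤ (m4 {t = t} {e₂ = e₂} _) = m≤n⊔m (suc (depth t)) (depthₑ e₂)
  ▷e⇒depthₑ≤ (m5 {t = t} {n = n} {e₁ = e₁} {s = s} {e₂ = e₂} _) =
    +-monoʳ-≤ (depthₑ (cons t n e₁)) (m≤n⊔m (suc (depth s)) (depthₑ e₂))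
  ▷e⇒depthₑ≤ (m6 {t = t} {e₁ = e₁} {s = s} {l = l} {e₂ = e₂}) =
    ≤-reflexive (sym (+-distribʳ-⊔ (depthₑ (cons s l e₂)) (suc (depth t)) (depthₑ e₁)))
  ▷e⇒depthₑ≤ (consᵗ {e = e} step) = ⊔-monoˡ-≤ (depthₑ e) (s≤s (▷t⇒depth≤ step))
  ▷e⇒depthₑ≤ (consᵉ {t = t} step) = ⊔-monoʳ-≤ (suc (depth t)) (▷e⇒depthₑ≤ step)
  ▷e⇒depthₑ≤ (mergeˡ {e₂ = e₂} step) = +-monoˡ-≤ (depthₑ e₂) (▷e⇒depthₑ≤ step)
  ▷e⇒depthₑ≤ (mergeʳ {e₁ = e₁} step) = +-monoʳ-≤ (depthₑ e₁) (▷e⇒depthₑ≤ step)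

▷e⇒len≡ : ∀ {e e′} → e ▷e e′ → len e′ ≡ len e
▷e⇒len≡ (m2 {e₁ = e₁} {nl₁ = nl₁}) =
  sym (trans (cong (len e₁ +_) (0∸n≡0 nl₁)) (+-identityʳ (len e₁)))
▷e⇒len≡ m3 = refl
▷e⇒len≡ (m4 (s≤s _)) = refl
▷e⇒len≡ (m5 (s≤s _)) = refl
▷e⇒len≡ m6 = refl
▷e⇒len≡ (consᵗ _) = refl
▷e⇒len≡ (consᵉ step) = cong suc (▷e⇒len≡ step)
▷e⇒len≡ (mergeˡ {nl₁ = nl₁} {e₂ = e₂} step) = cong (_+ (len e₂ ∸ nl₁)) (▷e⇒len≡ step)
▷e⇒len≡ (mergeʳ {e₁ = e₁} {nl₁ = nl₁} step) = cong (λ n → len e₁ + (n ∸ nl₁)) (▷e⇒len≡ step)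

-- The natural-number arguments are budgets bounding the measures; steps that do not lower a measure
-- keep its accessibility proof and only update the bound.
mutual
  susp-SN-below : ∀ {w} → Acc _<_ w → ∀ {t ol nl e} → SNₜ t → SNₑ e →
                  weight (susp t ol nl e) ≤ w → SNₜ (susp t ol nl e)
  susp-SN-below acc-w sn-t sn-e w≤ =
    acc (susp-reducts-SN acc-w (<-wellFounded _) (<-wellFounded _) (<-wellFounded _)
                         sn-t sn-e w≤ ≤-refl ≤-refl ≤-refl)

  merge-SN-below : ∀ {w} → Acc _<_ w → ∀ {e₁ nl ol e₂} → SNₑ e₁ → SNₑ e₂ →
                   weightₑ (merge e₁ nl ol e₂) ≤ w → SNₑ (merge e₁ nl ol e₂)
  merge-SN-below acc-w sn₁ sn₂ w≤ =
    acc (merge-reducts-SN acc-w (<-wellFounded _) (<-wellFounded _) sn₁ sn₂ w≤ ≤-refl ≤-refl)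

  susp-reducts-SN : ∀ {w d k m} → Acc _<_ w → Acc _<_ d → Acc _<_ k → Acc _<_ m →
                    ∀ {t ol nl e} → SNₜ t → SNₑ e →
                    weight (susp t ol nl e) ≤ w → depth (susp t ol nl e) ≤ d →
                    weight t ≤ k → len e ≤ m →
                    WfRec (flip _▷t_) SNₜ (susp t ol nl e)
  susp-reducts-SN acc-w acc-d acc-k acc-m (acc rec-t) sn-e w≤ d≤ k≤ m≤ step@(suspᵗ t▷) =
    acc (susp-reducts-SN acc-w acc-d acc-k acc-m (rec-t t▷) sn-e
          (≤-trans (▷t⇒weight≤ step) w≤) (≤-trans (▷t⇒depth≤ step) d≤)
          (≤-trans (▷t⇒weight≤ t▷) k≤) m≤)
  susp-reducts-SN acc-w acc-d acc-k acc-m sn-t (acc rec-e) w≤ d≤ k≤ m≤ step@(suspᵉ e▷) =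
    acc (susp-reducts-SN acc-w acc-d acc-k acc-m sn-t (rec-e e▷)
          (≤-trans (▷t⇒weight≤ step) w≤) (≤-trans (▷t⇒depth≤ step) d≤)
          k≤ (≤-trans (≤-reflexive (▷e⇒len≡ e▷)) m≤))
  susp-reducts-SN _ _ _ _ _ _ _ _ _ _ r1 = con-SNₜ
  susp-reducts-SN _ _ _ _ _ _ _ _ _ _ r2 = dB-SNₜ
  susp-reducts-SN acc-w (acc rec-d) _ _ _ sn-e w≤ d≤ _ _ step@(r3 {ol} {nl} {t} {l} {e}) =
    acc (susp-reducts-SN acc-w (rec-d (<-≤-trans (depth-r3< {t} {nl ∸ l} {ol} {nl} {l} {e}) d≤))
          (<-wellFounded (weight t)) (<-wellFounded 0) (SNₑ-cons-term sn-e) nil-SNₑ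
          (≤-trans (▷t⇒weight≤ step) w≤) ≤-refl ≤-refl z≤n)
  susp-reducts-SN acc-w acc-d acc-k (acc rec-m) _ sn-e w≤ d≤ _ m≤ step@(r4 _) =
    acc (susp-reducts-SN acc-w acc-d acc-k (rec-m m≤) dB-SNₜ (SNₑ-cons-env sn-e)
          (≤-trans (▷t⇒weight≤ step) w≤) (≤-trans (▷t⇒depth≤ step) d≤) z≤n ≤-refl)
  susp-reducts-SN {w} (acc rec-w) _ _ _ sn-t sn-e w≤ _ _ _
                  step@(r5 {t₁ = t} {t₂ = u} {ol = ol} {nl} {e}) =
    app-SNₜ (susp-SN-below (rec-w (≤-trans (s≤s (m≤m⊔n (weight t′) (weight u′))) reduct≤w))
                           (SNₜ-appˡ sn-t) sn-e ≤-refl)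
            (susp-SN-below (rec-w (≤-trans (s≤s (m≤n⊔m (weight t′) (weight u′))) reduct≤w))
                           (SNₜ-appʳ sn-t) sn-e ≤-refl)
    where
      t′ u′ : Term
      t′ = susp t ol nl e
      u′ = susp u ol nl e
      reduct≤w : weight (app t′ u′) ≤ w
      reduct≤w = ≤-trans (▷t⇒weight≤ step) w≤
  susp-reducts-SN (acc rec-w) _ _ _ sn-t sn-e w≤ _ _ _ step@r6 =
    lam-SNₜ (susp-SN-below (rec-w (≤-trans (▷t⇒weight≤ step) w≤))
                           (SNₜ-lam sn-t) (cons-SNₑ dB-SNₜ sn-e) ≤-refl)
  susp-reducts-SN {w} acc-w acc-d (acc rec-k) _ sn-t sn-e w≤ d≤ k≤ _
                  step@(m1 {t = t} {nl₁ = nl₁} {e₁ = e₁} {ol₂ = ol₂} {e₂ = e}) =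
    acc (susp-reducts-SN acc-w acc-d (rec-k (<-≤-trans (m<m+n (weight t) (1≤weightₑ e₁)) k≤))
          (<-wellFounded (len (merge e₁ nl₁ ol₂ e)))
          (SNₜ-susp-term sn-t) (merge-SN-below acc-w (SNₜ-susp-env sn-t) sn-e merge≤w)
          (≤-trans (▷t⇒weight≤ step) w≤) (≤-trans (▷t⇒depth≤ step) d≤) ≤-refl ≤-refl)
    where
      merge≤w : weightₑ (merge e₁ nl₁ ol₂ e) ≤ w
      merge≤w = ≤-trans (+-monoˡ-≤ (weightₑ e) (m≤n+m (weightₑ e₁) (weight t))) w≤

  merge-reducts-SN : ∀ {w m n} → Acc _<_ w → Acc _<_ m → Acc _<_ n →
                     ∀ {e₁ nl ol e₂} → SNₑ e₁ → SNₑ e₂ →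
                     weightₑ (merge e₁ nl ol e₂) ≤ w → len e₂ ≤ m → len e₁ ≤ n →
                     WfRec (flip _▷e_) SNₑ (merge e₁ nl ol e₂)
  merge-reducts-SN acc-w acc-m acc-n (acc rec₁) sn₂ w≤ m≤ n≤ step@(mergeˡ e₁▷) =
    acc (merge-reducts-SN acc-w acc-m acc-n (rec₁ e₁▷) sn₂
          (≤-trans (▷e⇒weightₑ≤ step) w≤) m≤ (≤-trans (≤-reflexive (▷e⇒len≡ e₁▷)) n≤))
  merge-reducts-SN acc-w acc-m acc-n sn₁ (acc rec₂) w≤ m≤ n≤ step@(mergeʳ e₂▷) =
    acc (merge-reducts-SN acc-w acc-m acc-n sn₁ (rec₂ e₂▷)
          (≤-trans (▷e⇒weightₑ≤ step) w≤) (≤-trans (≤-reflexive (▷e⇒len≡ e₂▷)) m≤) n≤)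
  merge-reducts-SN _ _ _ sn₁ _ _ _ _ m2 = sn₁
  merge-reducts-SN _ _ _ _ sn₂ _ _ _ m3 = sn₂
  merge-reducts-SN acc-w (acc rec-m) acc-n _ sn₂ w≤ m≤ _ step@(m4 _) =
    acc (merge-reducts-SN acc-w (rec-m m≤) acc-n nil-SNₑ (SNₑ-cons-env sn₂)
          (≤-trans (▷e⇒weightₑ≤ step) w≤) ≤-refl z≤n)
  merge-reducts-SN acc-w (acc rec-m) acc-n sn₁ sn₂ w≤ m≤ n≤ step@(m5 _) =
    acc (merge-reducts-SN acc-w (rec-m m≤) acc-n sn₁ (SNₑ-cons-env sn₂)
          (≤-trans (▷e⇒weightₑ≤ step) w≤) ≤-refl n≤)
  merge-reducts-SN {w} (acc rec-w) acc-m (acc rec-n) sn₁ sn₂ w≤ m≤ n≤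
                   step@(m6 {t = t} {n = n} {e₁ = e₁} {ol₂ = ol} {s = s} {l = l} {e₂ = e₂}) =
    cons-SNₑ (susp-SN-below (rec-w (≤-trans (m≤m⊔n (suc (weight t′)) (weightₑ e₁′)) reduct≤w))
                            (SNₑ-cons-term sn₁) sn₂ ≤-refl)
             (acc (merge-reducts-SN (acc rec-w) acc-m (rec-n n≤) (SNₑ-cons-env sn₁) sn₂
                    (≤-trans (m≤n⊔m (suc (weight t′)) (weightₑ e₁′)) reduct≤w) m≤ ≤-refl))
    where
      t′ : Term
      t′ = susp t ol l (cons s l e₂)
      e₁′ : Env
      e₁′ = merge e₁ n ol (cons s l e₂)
      reduct≤w : weightₑ (cons t′ (l + (n ∸ ol)) e₁′) ≤ w
      reduct≤w = ≤-trans (▷e⇒weightₑ≤ step) w≤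

mutual
  Term-SN : ∀ t → SNₜ t
  Term-SN (con _) = con-SNₜ
  Term-SN (mvar _) = mvar-SNₜ
  Term-SN (dB _) = dB-SNₜ
  Term-SN (app t u) = app-SNₜ (Term-SN t) (Term-SN u)
  Term-SN (lam t) = lam-SNₜ (Term-SN t)
  Term-SN (susp t _ _ e) = susp-SN-below (<-wellFounded _) (Term-SN t) (Env-SN e) ≤-refl

  Env-SN : ∀ e → SNₑ e
  Env-SN nil = nil-SNₑ
  Env-SN (cons t _ e) = cons-SNₑ (Term-SN t) (Env-SN e)
  Env-SN (merge e₁ _ _ e₂) = merge-SN-below (<-wellFounded _) (Env-SN e₁) (Env-SN e₂) ≤-refl

theorem3p6 : ¬ InfSeqT × ¬ InfSeqE
theorem3p6 = (λ (x , _ , steps) → acc⇒¬infiniteDescent (Term-SN (x zero)) steps)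
           , (λ (x , _ , steps) → acc⇒¬infiniteDescent (Env-SN (x zero)) steps)
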